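{- Let $p$ and $q$ be positive integers, let $v_1,\ldots,v_q$ be positive integers, and let $m_1<m_2<\cdots<m_q$ be positive integers. For $N\ge0$ let $A_N$ be the number of ways to tile an $N$-board using $v_i$ colours of $(1,p-1;m_i)$-combs for $i=1,\ldots,q$. Define $s_n$ by $s_n=v_1s_{n-m_1}+\cdots+v_qs_{n-m_q}+\delta_{n,0}$ for $n\ge0$, with $s_n=0$ for $n<0$. Then for all $n\ge0$ and $r=0,\ldots,p-1$, \[ A_{pn+r}=s_n^{p-r}s_{n+1}^r . \]
   Context: An $N$-board is a $1\times N$ strip of $N$ unit square cells, numbered $0,\ldots,N-1$. For positive integers $w$ (here $w=1$), $g\ge0$ and $m$, a $(w,g;m)$-comb is a tile consisting of $m$ rectangular sub-tiles ("teeth") of size $w\times1$ in a row, consecutive teeth separated by a gap of width $g$. Thus a $(1,p-1;m)$-comb placed on the board occupies cells $j,j+p,\ldots,j+(m-1)p$ for some $j$ (all within the board). A tiling of an $N$-board is a placement of combs such that each cell is occupied by exactly one tooth (gaps of one comb may contain teeth of other combs). Using $v_i$ colours of $(1,p-1;m_i)$-combs means each placed $(1,p-1;m_i)$-comb is assigned one of $v_i$ colours, and tilings differing in the placement or colours of combs are counted as different. $\delta_{i,j}$ is $1$ if $i=j$ and $0$ otherwise. -}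

module Defs where

open import Data.Nat using (ℕ; zero; suc; _+_; _*_; _∸_; _<_; _≤ᵇ_; _≟_)
open import Data.Fin using (Fin)
open import Data.Maybe using (Maybe; just; nothing)
open import Data.Product using (Σ; _×_; _,_)
open import Data.List using (List; []; _∷_; _++_; map; upTo; length; filter)
open import Data.List.Relation.Unary.All using (All)
open import Data.Vec using (Vec; []; _∷_; tabulate; sum)
open import Data.Bool using (if_then_else_)
open import Relation.Binary.PropositionalEquality using (_≡_)

δ₀ : ℕ → ℕ
δ₀ zero    = 1
δ₀ (suc _) = 0

sShift : (ℕ → ℕ) → ℕ → ℕ → ℕ
sShift s n k = if k ≤ᵇ n then s (n ∸ k) else 0

IsCombSeq : (q : ℕ) (v m : Fin q → ℕ) → (ℕ → ℕ) → Set
IsCombSeq q v m s =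
  (n : ℕ) → s n ≡ sum (tabulate (λ i → v i * sShift s n (m i))) + δ₀ n

CombKind : (q : ℕ) (v : Fin q → ℕ) → Set
CombKind q v = Σ (Fin q) (λ i → Fin (v i))

-- A placement of combs on an N-board is recorded by a vector indexed by the
-- cells: entry j is  just (i , c)  iff a (1,p-1;m_i)-comb of colour c has its
-- first (leftmost) tooth at cell j, and nothing otherwise.  (Every placed comb
-- has a unique leftmost cell, and two combs cannot share it in a tiling.)
Placement : (q : ℕ) (v : Fin q → ℕ) (N : ℕ) → Set
Placement q v N = Vec (Maybe (CombKind q v)) N

-- cells occupied by the teeth of all placed combs (with multiplicity);
-- a comb starting at cell j occupies j, j+p, ..., j+(m_i-1)p
teethCells : (p q : ℕ) (v m : Fin q → ℕ) {n : ℕ} →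
             ℕ → Vec (Maybe (CombKind q v)) n → List ℕ
teethCells p q v m off [] = []
teethCells p q v m off (nothing ∷ t) = teethCells p q v m (suc off) t
teethCells p q v m off (just (i , c) ∷ t) =
  map (λ k → off + k * p) (upTo (m i)) ++ teethCells p q v m (suc off) t

mult : ℕ → List ℕ → ℕ
mult x cs = length (filter (x ≟_) cs)

IsTiling : (p q : ℕ) (v m : Fin q → ℕ) (N : ℕ) → Placement q v N → Set
IsTiling p q v m N P =
  All (_< N) (teethCells p q v m 0 P) ×
  All (λ x → mult x (teethCells p q v m 0 P) ≡ 1) (upTo N)

Tiling : (p q : ℕ) (v m : Fin q → ℕ) (N : ℕ) → Set
Tiling p q v m N = Σ (Placement q v N) (IsTiling p q v m N)

-- The cells of an N-board fall into p residue classes mod p, and a (1,p-1;m)-comb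
-- lies in one class, where it occupies m consecutive cells.  Tilings of the board
-- are therefore tuples of independent tilings of the classes by coloured blocks of
-- lengths m_i, and a class of h cells has s_h of those; for N = pn + r, r classes
-- have n+1 cells and p-r have n.  To make this precise we scan the board from the
-- left, remembering for each of the next p cells how many teeth of an already
-- placed comb are still owed to its class.  Tilings are exactly the runs of this
-- scan from the all-zero window back to the all-zero window, and the number of runs
-- from a window factors over the classes.
{-# OPTIONS --safe #-}
module Submission where

open import Defs
open import Data.Empty using (⊥; ⊥-elim)
open import Data.Fin using (Fin; zero; suc; toℕ)
open import Data.Fin.Properties using (+↔⊎; *↔×)
open import Data.List using (List; []; _∷_; _++_; [_]; _∷ʳ_; map; upTo; applyUpTo; length; filter; replicate)
open import Data.List.Properties
  using (++-assoc; ++-identityʳ; length-++; length-replicate; map-++; map-∘; map-upTo; map-applyUpTo;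
         filter-++; filter-accept; filter-reject; filter-none)
open import Data.List.Membership.Propositional using (_∈_)
open import Data.List.Membership.Propositional.Properties using (∈-upTo⁺; ∈-upTo⁻)
open import Data.List.Relation.Unary.All as All using (All; []; _∷_)
open import Data.List.Relation.Unary.Any using (here; there)
open import Data.Maybe using (Maybe; just; nothing)
open import Data.Nat
open import Data.Nat.Properties
open import Algebra.Properties.CommutativeSemigroup *-commutativeSemigroup using (x∙yz≈y∙xz)
open import Data.Product using (Σ; _×_; _,_)
open import Data.Product.Function.Dependent.Propositional using (Σ-↔)
open import Data.Product.Function.NonDependent.Propositional using (_×-↔_)
open import Data.Sum using (_⊎_; inj₁; inj₂)
open import Data.Sum.Function.Propositional using (_⊎-↔_)
open import Data.Unit using (⊤; tt)
open import Data.Vec using (Vec; []; _∷_; tabulate; sum)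
open import Data.Vec.Properties using (tabulate-cong)
open import Function using (_∘_)
open import Function.Bundles using (_↔_; _⇔_; mk↔ₛ′; mk⇔; Equivalence)
open import Function.Construct.Composition using (_⇔-∘_)
open import Function.Construct.Symmetry using (⇔-sym)
open import Function.Properties.Inverse using (↔-refl; ↔-sym; ↔-trans)
open import Relation.Nullary using (yes; no; Irrelevant; contradiction)
open import Relation.Binary.PropositionalEquality hiding ([_])

open ≡-Reasoning

length-∷ʳ : ∀ (xs : List ℕ) x → length (xs ∷ʳ x) ≡ suc (length xs)
length-∷ʳ xs x = trans (length-++ xs) (+-comm (length xs) 1)

mult-∷-≡ : ∀ x xs → mult x (x ∷ xs) ≡ suc (mult x xs)
mult-∷-≡ x xs = cong length (filter-accept (x ≟_) refl)

mult-∷-≢ : ∀ {x y} xs → x ≢ y → mult x (y ∷ xs) ≡ mult x xs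
mult-∷-≢ {x} xs x≢y = cong length (filter-reject (x ≟_) x≢y)

mult-++ : ∀ x xs ys → mult x (xs ++ ys) ≡ mult x xs + mult x ys
mult-++ x xs ys = trans (cong length (filter-++ (x ≟_) xs ys)) (length-++ (filter (x ≟_) xs))

mult-map-suc : ∀ x xs → mult (suc x) (map suc xs) ≡ mult x xs
mult-map-suc x [] = refl
mult-map-suc x (y ∷ xs) with x ≟ y
... | yes refl = trans (mult-∷-≡ (suc x) (map suc xs))
                   (trans (cong suc (mult-map-suc x xs)) (sym (mult-∷-≡ x xs)))
... | no x≢y = trans (mult-∷-≢ (map suc xs) (x≢y ∘ suc-injective))
                 (trans (mult-map-suc x xs) (sym (mult-∷-≢ xs x≢y)))

mult-zero-map-suc : ∀ xs → mult 0 (map suc xs) ≡ 0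
mult-zero-map-suc [] = refl
mult-zero-map-suc (_ ∷ xs) = mult-zero-map-suc xs

∈⇒mult-pos : ∀ {x xs} → x ∈ xs → 0 < mult x xs
∈⇒mult-pos {x} {_ ∷ xs} (here refl) = subst (0 <_) (sym (mult-∷-≡ x xs)) z<s
∈⇒mult-pos {x} {y ∷ xs} (there x∈xs) with x ≟ y
... | yes refl = subst (0 <_) (sym (mult-∷-≡ x xs)) z<s
... | no x≢y = subst (0 <_) (sym (mult-∷-≢ xs x≢y)) (∈⇒mult-pos x∈xs)

mult-outside : ∀ {N x xs} → N ≤ x → All (_< N) xs → mult x xs ≡ 0
mult-outside {N} {x} N≤x inside =
  cong length (filter-none (x ≟_) (All.map (λ y<N x≡y → <⇒≱ y<N (subst (N ≤_) x≡y N≤x)) inside))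

⟦_<_⟧ : ℕ → ℕ → ℕ
⟦ x < zero ⟧ = 0
⟦ zero < suc N ⟧ = 1
⟦ suc x < suc N ⟧ = ⟦ x < N ⟧

⟦<⟧-< : ∀ {x N} → x < N → ⟦ x < N ⟧ ≡ 1
⟦<⟧-< {zero} {suc N} _ = refl
⟦<⟧-< {suc x} {suc N} (s≤s x<N) = ⟦<⟧-< x<N

⟦<⟧-≥ : ∀ {x N} → N ≤ x → ⟦ x < N ⟧ ≡ 0
⟦<⟧-≥ {N = zero} _ = refl
⟦<⟧-≥ {suc x} {suc N} (s≤s N≤x) = ⟦<⟧-≥ N≤x

⟦<⟧-pos : ∀ {x N} → 0 < ⟦ x < N ⟧ → x < N
⟦<⟧-pos {zero} {suc N} _ = z<s
⟦<⟧-pos {suc x} {suc N} pos = s<s (⟦<⟧-pos pos)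

exactCover⇔ : ∀ N xs →
  (All (_< N) xs × All (λ x → mult x xs ≡ 1) (upTo N)) ⇔ (∀ x → mult x xs ≡ ⟦ x < N ⟧)
exactCover⇔ N xs = mk⇔ to from
  where
  to : All (_< N) xs × All (λ x → mult x xs ≡ 1) (upTo N) → ∀ x → mult x xs ≡ ⟦ x < N ⟧
  to (inside , once) x with x <? N
  ... | yes x<N = trans (All.lookup once (∈-upTo⁺ x<N)) (sym (⟦<⟧-< x<N))
  ... | no x≮N = trans (mult-outside (≮⇒≥ x≮N) inside) (sym (⟦<⟧-≥ (≮⇒≥ x≮N)))
  from : (∀ x → mult x xs ≡ ⟦ x < N ⟧) → All (_< N) xs × All (λ x → mult x xs ≡ 1) (upTo N)
  from exact = All.tabulate (λ {y} y∈xs → ⟦<⟧-pos (subst (0 <_) (exact y) (∈⇒mult-pos y∈xs)))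
             , All.tabulate (λ {x} x∈upTo → trans (exact x) (⟦<⟧-< (∈-upTo⁻ x∈upTo)))

sum-tabulate-*ˡ : ∀ {q} c (f : Fin q → ℕ) → sum (tabulate (λ i → c * f i)) ≡ c * sum (tabulate f)
sum-tabulate-*ˡ {zero} c f = sym (*-zeroʳ c)
sum-tabulate-*ˡ {suc q} c f =
  trans (cong (c * f zero +_) (sum-tabulate-*ˡ c (f ∘ suc))) (sym (*-distribˡ-+ c (f zero) _))

sum-tabulate-zero : ∀ {q} {f : Fin q → ℕ} → (∀ i → f i ≡ 0) → sum (tabulate f) ≡ 0
sum-tabulate-zero {q} f≡0 = trans (cong sum (tabulate-cong f≡0)) (sum-tabulate-*ˡ {q} 0 (λ _ → 0))

Σ-Fin-suc↔ : ∀ {q} (B : Fin (suc q) → Set) → Σ (Fin (suc q)) B ↔ (B zero ⊎ Σ (Fin q) (B ∘ suc))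
Σ-Fin-suc↔ B = mk↔ₛ′ to from to∘from from∘to
  where
  to : Σ (Fin _) B → B zero ⊎ Σ (Fin _) (B ∘ suc)
  to (zero , b) = inj₁ b
  to (suc i , b) = inj₂ (i , b)
  from : B zero ⊎ Σ (Fin _) (B ∘ suc) → Σ (Fin _) B
  from (inj₁ b) = zero , b
  from (inj₂ (i , b)) = suc i , b
  to∘from : ∀ y → to (from y) ≡ y
  to∘from (inj₁ b) = refl
  to∘from (inj₂ (i , b)) = refl
  from∘to : ∀ x → from (to x) ≡ x
  from∘to (zero , b) = refl
  from∘to (suc i , b) = refl

Σ-Fin↔sum : ∀ {q} (f : Fin q → ℕ) → Σ (Fin q) (Fin ∘ f) ↔ Fin (sum (tabulate f))
Σ-Fin↔sum {zero} f = mk↔ₛ′ (λ { (() , _) }) (λ ()) (λ ()) (λ { (() , _) })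
Σ-Fin↔sum {suc q} f =
  ↔-trans (Σ-Fin-suc↔ (Fin ∘ f)) (↔-trans (↔-refl ⊎-↔ Σ-Fin↔sum (f ∘ suc)) (↔-sym +↔⊎))

irrelevant-⇔⇒↔ : {A B : Set} → Irrelevant A → Irrelevant B → A ⇔ B → A ↔ B
irrelevant-⇔⇒↔ irrA irrB A⇔B = mk↔ₛ′ to from (λ _ → irrB _ _) (λ _ → irrA _ _)
  where open Equivalence A⇔B

sShift-suc : ∀ (s : ℕ → ℕ) h k → sShift s (suc h) (suc k) ≡ sShift s h k
sShift-suc s h zero = refl
sShift-suc s h (suc k) = refl

sShift-zero : ∀ (s : ℕ → ℕ) {k} → 1 ≤ k → sShift s 0 k ≡ 0
sShift-zero s (s≤s _) = refl

AllZero : List ℕ → Set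
AllZero [] = ⊤
AllZero (zero ∷ ds) = AllZero ds
AllZero (suc _ ∷ _) = ⊥

allZero-irrelevant : ∀ ds → Irrelevant (AllZero ds)
allZero-irrelevant [] tt tt = refl
allZero-irrelevant (zero ∷ ds) = allZero-irrelevant ds

allZero-∷ʳ : ∀ ds → AllZero ds → AllZero (ds ∷ʳ 0)
allZero-∷ʳ [] _ = tt
allZero-∷ʳ (zero ∷ ds) z = allZero-∷ʳ ds z

allZero-replicate : ∀ n → AllZero (replicate n 0)
allZero-replicate zero = tt
allZero-replicate (suc n) = allZero-replicate n

-- Window d₀ ∷ d₁ ∷ … at cell j: cells j+k, j+k+p, …, j+k+(d_k-1)p are owed to a comb
-- already placed.  covered d x counts the owed teeth at cell j+x.
covered : List ℕ → ℕ → ℕ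
covered [] _ = 0
covered (d ∷ ds) zero = 1 ⊓ d
covered (d ∷ ds) (suc x) = covered (ds ∷ʳ pred d) x

allZero⇒covered≡0 : ∀ ds → AllZero ds → ∀ x → covered ds x ≡ 0
allZero⇒covered≡0 [] _ _ = refl
allZero⇒covered≡0 (zero ∷ ds) z zero = refl
allZero⇒covered≡0 (zero ∷ ds) z (suc x) = allZero⇒covered≡0 (ds ∷ʳ 0) (allZero-∷ʳ ds z) x

covered≡0⇒allZero : ∀ ds es → (∀ x → covered (ds ++ es) x ≡ 0) → AllZero ds
covered≡0⇒allZero [] es _ = tt
covered≡0⇒allZero (zero ∷ ds) es idle =
  covered≡0⇒allZero ds (es ∷ʳ 0)
    (λ x → trans (cong (λ w → covered w x) (sym (++-assoc ds es [ 0 ]))) (idle (suc x)))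
covered≡0⇒allZero (suc _ ∷ ds) es idle with idle 0
... | ()

-- LaneHeights L hs: of the last L cells of a board, hs_k lie in the class of window slot k.
LaneHeights : ℕ → List ℕ → Set
LaneHeights zero hs = AllZero hs
LaneHeights (suc L) [] = ⊥
LaneHeights (suc L) (zero ∷ _) = ⊥
LaneHeights (suc L) (suc h ∷ hs) = LaneHeights L (hs ∷ʳ h)

replicate-∷ʳ : ∀ k (n : ℕ) → replicate k n ∷ʳ n ≡ replicate (suc k) n
replicate-∷ʳ zero n = refl
replicate-∷ʳ (suc k) n = cong (n ∷_) (replicate-∷ʳ k n)

laneHeights-board : ∀ {p} n r k → r + k ≡ p →
                    LaneHeights (p * n + r) (replicate r (suc n) ++ replicate k n)
laneHeights-board zero zero k refl =
  subst (λ L → LaneHeights L (replicate k 0)) (sym (trans (+-identityʳ (k * 0)) (*-zeroʳ k)))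
    (allZero-replicate k)
laneHeights-board (suc n) zero k refl =
  subst₂ LaneHeights (trans (+-comm (k * n) k) (sym (trans (+-identityʳ _) (*-suc k n))))
    (++-identityʳ (replicate k (suc n)))
    (laneHeights-board n k 0 (+-identityʳ k))
laneHeights-board {p} n (suc r) k r+k≡p =
  subst (λ L → LaneHeights L (replicate (suc r) (suc n) ++ replicate k n)) (sym (+-suc (p * n) r))
    (subst (LaneHeights (p * n + r)) rotate (laneHeights-board n r (suc k) (trans (+-suc r k) r+k≡p)))
  where
  rotate : replicate r (suc n) ++ replicate (suc k) n ≡ (replicate r (suc n) ++ replicate k n) ∷ʳ n
  rotate = trans (cong (replicate r (suc n) ++_) (sym (replicate-∷ʳ k n)))
                 (sym (++-assoc (replicate r (suc n)) (replicate k n) [ n ]))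

module Window (p′ : ℕ) where

  p : ℕ
  p = suc p′

  lane : ℕ → ℕ → List ℕ
  lane j n = applyUpTo (λ k → j + k * p) n

  mult-zero-lane-suc : ∀ j n → mult 0 (lane (suc j) n) ≡ 0
  mult-zero-lane-suc j n =
    trans (cong (mult 0) (sym (map-applyUpTo (λ k → j + k * p) suc n))) (mult-zero-map-suc (lane j n))

  mult-suc-lane-suc : ∀ x j n → mult (suc x) (lane (suc j) n) ≡ mult x (lane j n)
  mult-suc-lane-suc x j n =
    trans (cong (mult (suc x)) (sym (map-applyUpTo (λ k → j + k * p) suc n))) (mult-map-suc x (lane j n))

  -- A comb of n teeth starting in window slot j = length ds puts on every cell exactly
  -- the teeth that n teeth owed in slot j would.
  covered-lane : ∀ x (ds es : List ℕ) n → length ds + length es ≡ p′ →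
                 mult x (lane (length ds) n) + covered (ds ++ 0 ∷ es) x ≡ covered (ds ++ n ∷ es) x
  covered-lane zero [] es zero _ = refl
  covered-lane zero [] es (suc n) _ = cong suc (trans (+-identityʳ _) (mult-zero-lane-suc p′ n))
  covered-lane zero (d ∷ ds) es n _ = cong (_+ 1 ⊓ d) (mult-zero-lane-suc (length ds) n)
  covered-lane (suc x) [] es zero _ = refl
  covered-lane (suc x) [] es (suc n) len =
    trans (cong (_+ covered (es ∷ʳ 0) x) (mult-suc-lane-suc x p′ n))
      (subst (λ j → mult x (lane j n) + covered (es ∷ʳ 0) x ≡ covered (es ∷ʳ n) x) len
        (covered-lane x es [] n (trans (+-identityʳ (length es)) len)))
  covered-lane (suc x) (d ∷ ds) es n len
    rewrite ++-assoc ds (0 ∷ es) [ pred d ] | ++-assoc ds (n ∷ es) [ pred d ] =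
    trans (cong (_+ covered (ds ++ 0 ∷ es ∷ʳ pred d) x) (mult-suc-lane-suc x (length ds) n))
      (covered-lane x ds (es ∷ʳ pred d) n
        (trans (cong (length ds +_) (length-∷ʳ es (pred d))) (trans (+-suc (length ds) (length es)) len)))

module Scan {q : ℕ} (v m : Fin q → ℕ) where

  Cell : Set
  Cell = Maybe (CombKind q v)

  -- Completes P ds: P extends a partial tiling whose owed teeth are given by the window ds.
  Completes : ∀ {L} → Vec Cell L → List ℕ → Set
  Completes [] ds = AllZero ds
  Completes (_ ∷ _) [] = ⊥
  Completes (nothing ∷ P) (zero ∷ ds) = ⊥
  Completes (nothing ∷ P) (suc k ∷ ds) = Completes P (ds ∷ʳ k)
  Completes (just (i , _) ∷ P) (zero ∷ ds) = Completes P (ds ∷ʳ pred (m i))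
  Completes (just _ ∷ P) (suc _ ∷ _) = ⊥

  completes-irrelevant : ∀ {L} (P : Vec Cell L) ds → Irrelevant (Completes P ds)
  completes-irrelevant [] ds = allZero-irrelevant ds
  completes-irrelevant (nothing ∷ P) (suc k ∷ ds) = completes-irrelevant P (ds ∷ʳ k)
  completes-irrelevant (just (i , _) ∷ P) (zero ∷ ds) = completes-irrelevant P (ds ∷ʳ pred (m i))

  Completions : ℕ → List ℕ → Set
  Completions L ds = Σ (Vec Cell L) (λ P → Completes P ds)

  count : ℕ → List ℕ → ℕ
  count zero [] = 1
  count zero (zero ∷ ds) = count zero ds
  count zero (suc _ ∷ _) = 0
  count (suc L) [] = 0
  count (suc L) (suc k ∷ ds) = count L (ds ∷ʳ k)
  count (suc L) (zero ∷ ds) = sum (tabulate (λ i → v i * count L (ds ∷ʳ pred (m i))))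

  allZero↔ : ∀ ds → AllZero ds ↔ Fin (count zero ds)
  allZero↔ [] = mk↔ₛ′ (λ _ → zero) (λ _ → tt) (λ { zero → refl }) (λ { tt → refl })
  allZero↔ (zero ∷ ds) = allZero↔ ds
  allZero↔ (suc _ ∷ ds) = mk↔ₛ′ (λ ()) (λ ()) (λ ()) (λ ())

  completions-owed↔ : ∀ L k ds → Completions (suc L) (suc k ∷ ds) ↔ Completions L (ds ∷ʳ k)
  completions-owed↔ L k ds = mk↔ₛ′ to (λ (P , c) → nothing ∷ P , c) (λ _ → refl) from∘to
    where
    to : Completions (suc L) (suc k ∷ ds) → Completions L (ds ∷ʳ k)
    to (nothing ∷ P , c) = P , c
    from∘to : ∀ x → (nothing ∷ _ , _) ≡ x
    from∘to (nothing ∷ P , c) = refl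

  completions-free↔ : ∀ L ds → Completions (suc L) (zero ∷ ds) ↔
                      Σ (Fin q) (λ i → Fin (v i) × Completions L (ds ∷ʳ pred (m i)))
  completions-free↔ L ds = mk↔ₛ′ to (λ (i , c , P , ok) → just (i , c) ∷ P , ok) (λ _ → refl) from∘to
    where
    to : Completions (suc L) (zero ∷ ds) → Σ (Fin q) (λ i → Fin (v i) × Completions L (ds ∷ʳ pred (m i)))
    to (just (i , c) ∷ P , ok) = i , c , P , ok
    from∘to : ∀ x → (just _ ∷ _ , _) ≡ x
    from∘to (just (i , c) ∷ P , ok) = refl

  completions↔ : ∀ L ds → Completions L ds ↔ Fin (count L ds)
  completions↔ zero ds =
    ↔-trans (mk↔ₛ′ (λ { ([] , z) → z }) ([] ,_) (λ _ → refl) (λ { ([] , z) → refl })) (allZero↔ ds)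
  completions↔ (suc L) [] = mk↔ₛ′ (λ { (_ ∷ _ , ()) }) (λ ()) (λ ()) (λ { (_ ∷ _ , ()) })
  completions↔ (suc L) (suc k ∷ ds) = ↔-trans (completions-owed↔ L k ds) (completions↔ L (ds ∷ʳ k))
  completions↔ (suc L) (zero ∷ ds) =
    ↔-trans (completions-free↔ L ds)
      (↔-trans (Σ-↔ ↔-refl (↔-trans (↔-refl ×-↔ completions↔ L _) (↔-sym *↔×))) (Σ-Fin↔sum _))

module Tilings (p′ : ℕ) {q : ℕ} (v m : Fin q → ℕ) (m-pos : ∀ i → 1 ≤ m i) where
  open Window p′
  open Scan v m

  teeth : ∀ {L} → ℕ → Vec Cell L → List ℕ
  teeth = teethCells p q v m

  teeth-suc : ∀ {L} off (P : Vec Cell L) → teeth (suc off) P ≡ map suc (teeth off P)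
  teeth-suc off [] = refl
  teeth-suc off (nothing ∷ P) = teeth-suc (suc off) P
  teeth-suc off (just (i , _) ∷ P) =
    trans (cong₂ _++_ (map-∘ (upTo (m i))) (teeth-suc (suc off) P))
      (sym (map-++ suc (map (λ k → off + k * p) (upTo (m i))) (teeth (suc off) P)))

  coverage : ∀ {L} → List ℕ → Vec Cell L → ℕ → ℕ
  coverage ds P x = covered ds x + mult x (teeth 0 P)

  Covers : ∀ {L} → List ℕ → Vec Cell L → Set
  Covers {L} ds P = ∀ x → coverage ds P x ≡ ⟦ x < L ⟧

  covers-step : ∀ {L} ds es e (P : Vec Cell L) →
                coverage ds (e ∷ P) 0 ≡ 1 → (∀ x → coverage ds (e ∷ P) (suc x) ≡ coverage es P x) →
                Covers es P ⇔ Covers ds (e ∷ P)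
  covers-step _ _ _ _ head tail =
    mk⇔ (λ { C zero → head ; C (suc x) → trans (tail x) (C x) }) (λ C x → trans (sym (tail x)) (C (suc x)))

  mult-zero-teeth-one : ∀ {L} (P : Vec Cell L) → mult 0 (teeth 1 P) ≡ 0
  mult-zero-teeth-one P = trans (cong (mult 0) (teeth-suc 0 P)) (mult-zero-map-suc (teeth 0 P))

  mult-suc-teeth-one : ∀ {L} (P : Vec Cell L) x → mult (suc x) (teeth 1 P) ≡ mult x (teeth 0 P)
  mult-suc-teeth-one P x = trans (cong (mult (suc x)) (teeth-suc 0 P)) (mult-map-suc x (teeth 0 P))

  mult-comb-teeth : ∀ {L} x i c (P : Vec Cell L) →
                    mult x (teeth 0 (just (i , c) ∷ P)) ≡ mult x (lane 0 (m i)) + mult x (teeth 1 P)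
  mult-comb-teeth x i c P =
    trans (mult-++ x (map (λ k → 0 + k * p) (upTo (m i))) (teeth 1 P))
      (cong (λ l → mult x l + mult x (teeth 1 P)) (map-upTo (λ k → 0 + k * p) (m i)))

  mult-zero-lane-zero : ∀ n → 1 ≤ n → mult 0 (lane 0 n) ≡ 1
  mult-zero-lane-zero (suc n) _ = cong suc (mult-zero-lane-suc p′ n)

  empty-head : ∀ {L} d ds (P : Vec Cell L) → coverage (d ∷ ds) (nothing ∷ P) 0 ≡ 1 ⊓ d
  empty-head d _ P = trans (cong (1 ⊓ d +_) (mult-zero-teeth-one P)) (+-identityʳ (1 ⊓ d))

  empty-tail : ∀ {L} k ds (P : Vec Cell L) x →
               coverage (suc k ∷ ds) (nothing ∷ P) (suc x) ≡ coverage (ds ∷ʳ k) P x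
  empty-tail k ds P x = cong (covered (ds ∷ʳ k) x +_) (mult-suc-teeth-one P x)

  comb-head : ∀ {L} d ds i c (P : Vec Cell L) → coverage (d ∷ ds) (just (i , c) ∷ P) 0 ≡ 1 ⊓ d + 1
  comb-head d _ i c P =
    cong (1 ⊓ d +_) (trans (mult-comb-teeth 0 i c P)
      (cong₂ _+_ (mult-zero-lane-zero (m i) (m-pos i)) (mult-zero-teeth-one P)))

  comb-tail : ∀ {L} ds i c (P : Vec Cell L) → length ds ≡ p′ → ∀ x →
              coverage (0 ∷ ds) (just (i , c) ∷ P) (suc x) ≡ coverage (ds ∷ʳ pred (m i)) P x
  comb-tail ds i c P len x = begin
    covered (0 ∷ ds) (suc x) + mult (suc x) (teeth 0 (just (i , c) ∷ P))
      ≡⟨ cong (covered (0 ∷ ds) (suc x) +_)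
           (trans (mult-comb-teeth (suc x) i c P) (cong (comb +_) (mult-suc-teeth-one P x))) ⟩
    covered (0 ∷ ds) (suc x) + (comb + mult x (teeth 0 P))
      ≡⟨ +-assoc (covered (0 ∷ ds) (suc x)) comb _ ⟨
    covered (0 ∷ ds) (suc x) + comb + mult x (teeth 0 P)
      ≡⟨ cong (_+ mult x (teeth 0 P)) (+-comm _ comb) ⟩
    comb + covered (0 ∷ ds) (suc x) + mult x (teeth 0 P)
      ≡⟨ cong (_+ mult x (teeth 0 P)) (covered-lane (suc x) [] ds (m i) len) ⟩
    covered (ds ∷ʳ pred (m i)) x + mult x (teeth 0 P) ∎
    where
    comb : ℕ
    comb = mult (suc x) (lane 0 (m i))

  completes⇔covers : ∀ {L} (P : Vec Cell L) ds → length ds ≡ p → Completes P ds ⇔ Covers ds P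
  completes⇔covers [] ds _ =
    mk⇔ (λ z x → trans (+-identityʳ _) (allZero⇒covered≡0 ds z x))
        (λ C → covered≡0⇒allZero ds [] (λ x → trans (cong (λ w → covered w x) (++-identityʳ ds))
                                                  (trans (sym (+-identityʳ _)) (C x))))
  completes⇔covers (nothing ∷ P) (zero ∷ ds) _ =
    mk⇔ ⊥-elim (λ C → contradiction (trans (sym (empty-head 0 ds P)) (C 0)) λ ())
  completes⇔covers (nothing ∷ P) (suc k ∷ ds) len =
    covers-step (suc k ∷ ds) (ds ∷ʳ k) nothing P (empty-head (suc k) ds P) (empty-tail k ds P)
      ⇔-∘ completes⇔covers P (ds ∷ʳ k) (trans (length-∷ʳ ds k) len)
  completes⇔covers (just (i , c) ∷ P) (zero ∷ ds) len =
    covers-step (0 ∷ ds) (ds ∷ʳ pred (m i)) (just (i , c)) P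
                (comb-head 0 ds i c P) (comb-tail ds i c P (suc-injective len))
      ⇔-∘ completes⇔covers P (ds ∷ʳ pred (m i)) (trans (length-∷ʳ ds _) len)
  completes⇔covers (just (i , c) ∷ P) (suc k ∷ ds) _ =
    mk⇔ ⊥-elim (λ C → contradiction (trans (sym (comb-head (suc k) ds i c P)) (C 0)) λ ())

  tiling⇔completes : ∀ {N} (P : Vec Cell N) → IsTiling p q v m N P ⇔ Completes P (replicate p 0)
  tiling⇔completes {N} P =
    ⇔-sym (completes⇔covers P (replicate p 0) (length-replicate p))
      ⇔-∘ (mk⇔ (λ exact x → trans (idle x) (exact x)) (λ C x → trans (sym (idle x)) (C x))
      ⇔-∘ exactCover⇔ N (teeth 0 P))
    where
    idle : ∀ x → coverage (replicate p 0) P x ≡ mult x (teeth 0 P)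
    idle x = cong (_+ mult x (teeth 0 P)) (allZero⇒covered≡0 (replicate p 0) (allZero-replicate p) x)

  tiling-irrelevant : ∀ {N} (P : Vec Cell N) → Irrelevant (IsTiling p q v m N P)
  tiling-irrelevant P (a , b) (a′ , b′) =
    cong₂ _,_ (All.irrelevant <-irrelevant a a′) (All.irrelevant ≡-irrelevant b b′)

  tilings↔completions : ∀ N → Tiling p q v m N ↔ Completions N (replicate p 0)
  tilings↔completions N =
    Σ-↔ ↔-refl (λ {P} → irrelevant-⇔⇒↔ (tiling-irrelevant P)
                          (completes-irrelevant P (replicate p 0)) (tiling⇔completes P))

module Counting {q : ℕ} (v m : Fin q → ℕ) (m-pos : ∀ i → 1 ≤ m i)
                (s : ℕ → ℕ) (rec : IsCombSeq q v m s) where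
  open Scan v m

  -- A class with h remaining cells, the first d of them owed, has s_(h-d) completions.
  laneProduct : List ℕ → List ℕ → ℕ
  laneProduct [] _ = 1
  laneProduct (_ ∷ _) [] = 1
  laneProduct (h ∷ hs) (d ∷ ds) = sShift s h d * laneProduct hs ds

  s-zero : s 0 ≡ 1
  s-zero = trans (rec 0) (cong (_+ 1)
    (sum-tabulate-zero (λ i → trans (cong (v i *_) (sShift-zero s (m-pos i))) (*-zeroʳ (v i)))))

  s-suc : ∀ h → s (suc h) ≡ sum (tabulate (λ i → v i * sShift s h (pred (m i))))
  s-suc h = trans (rec (suc h))
    (trans (+-identityʳ _) (cong sum (tabulate-cong (λ i → cong (v i *_) (unshift (m-pos i))))))
    where
    unshift : ∀ {k} → 1 ≤ k → sShift s (suc h) k ≡ sShift s h (pred k)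
    unshift {suc k} _ = sShift-suc s h k

  laneProduct-∷ʳ : ∀ hs ds h d → length ds ≡ length hs →
                   laneProduct (hs ∷ʳ h) (ds ∷ʳ d) ≡ laneProduct hs ds * sShift s h d
  laneProduct-∷ʳ [] [] h d _ = trans (*-identityʳ _) (sym (+-identityʳ _))
  laneProduct-∷ʳ (h′ ∷ hs) (d′ ∷ ds) h d len =
    trans (cong (sShift s h′ d′ *_) (laneProduct-∷ʳ hs ds h d (suc-injective len)))
      (sym (*-assoc (sShift s h′ d′) (laneProduct hs ds) _))

  laneProduct-idle : ∀ hs ds → length ds ≡ length hs → AllZero hs → laneProduct hs ds ≡ count 0 ds
  laneProduct-idle [] [] _ _ = refl
  laneProduct-idle (zero ∷ hs) (zero ∷ ds) len z =
    trans (cong (_* laneProduct hs ds) s-zero)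
      (trans (+-identityʳ _) (laneProduct-idle hs ds (suc-injective len) z))
  laneProduct-idle (zero ∷ hs) (suc _ ∷ ds) _ _ = refl

  count≡laneProduct : ∀ L hs ds → length ds ≡ length hs → LaneHeights L hs →
                      count L ds ≡ laneProduct hs ds
  count-∷ʳ : ∀ L hs ds h d → length ds ≡ length hs → LaneHeights L (hs ∷ʳ h) →
             count L (ds ∷ʳ d) ≡ laneProduct hs ds * sShift s h d

  count-∷ʳ L hs ds h d len heights =
    trans (count≡laneProduct L (hs ∷ʳ h) (ds ∷ʳ d) lengths heights) (laneProduct-∷ʳ hs ds h d len)
    where
    lengths : length (ds ∷ʳ d) ≡ length (hs ∷ʳ h)
    lengths = trans (length-∷ʳ ds d) (trans (cong suc len) (sym (length-∷ʳ hs h)))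

  count≡laneProduct zero hs ds len heights = sym (laneProduct-idle hs ds len heights)
  count≡laneProduct (suc L) (suc h ∷ hs) (suc k ∷ ds) len heights = begin
    count L (ds ∷ʳ k)                            ≡⟨ count-∷ʳ L hs ds h k (suc-injective len) heights ⟩
    laneProduct hs ds * sShift s h k             ≡⟨ *-comm (laneProduct hs ds) _ ⟩
    sShift s h k * laneProduct hs ds             ≡⟨ cong (_* laneProduct hs ds) (sShift-suc s h k) ⟨
    sShift s (suc h) (suc k) * laneProduct hs ds ∎
  count≡laneProduct (suc L) (suc h ∷ hs) (zero ∷ ds) len heights = begin
    sum (tabulate (λ i → v i * count L (ds ∷ʳ pred (m i))))
      ≡⟨ cong sum (tabulate-cong (λ i → trans (cong (v i *_) (count-∷ʳ L hs ds h _ (suc-injective len) heights))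
                                              (x∙yz≈y∙xz (v i) (laneProduct hs ds) _))) ⟩
    sum (tabulate (λ i → laneProduct hs ds * (v i * sShift s h (pred (m i)))))
      ≡⟨ sum-tabulate-*ˡ (laneProduct hs ds) (λ i → v i * sShift s h (pred (m i))) ⟩
    laneProduct hs ds * sum (tabulate (λ i → v i * sShift s h (pred (m i))))
      ≡⟨ cong (laneProduct hs ds *_) (s-suc h) ⟨
    laneProduct hs ds * s (suc h)
      ≡⟨ *-comm (laneProduct hs ds) _ ⟩
    s (suc h) * laneProduct hs ds ∎

  laneProduct-replicate : ∀ r k a b →
    laneProduct (replicate r a ++ replicate k b) (replicate (r + k) 0) ≡ s a ^ r * s b ^ k
  laneProduct-replicate zero k a b = trans (powers k) (sym (+-identityʳ _))
    where
    powers : ∀ k → laneProduct (replicate k b) (replicate k 0) ≡ s b ^ k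
    powers zero = refl
    powers (suc k) = cong (s b *_) (powers k)
  laneProduct-replicate (suc r) k a b =
    trans (cong (s a *_) (laneProduct-replicate r k a b)) (sym (*-assoc (s a) _ _))

  count-board : ∀ p n r → r ≤ p → count (p * n + r) (replicate p 0) ≡ s n ^ (p ∸ r) * s (suc n) ^ r
  count-board p n r r≤p = begin
    count (p * n + r) (replicate p 0)
      ≡⟨ cong (count (p * n + r) ∘ (λ w → replicate w 0)) r+[p∸r]≡p ⟨
    count (p * n + r) (replicate (r + (p ∸ r)) 0)
      ≡⟨ count≡laneProduct (p * n + r) heights _ lengths (laneHeights-board n r (p ∸ r) r+[p∸r]≡p) ⟩
    laneProduct heights (replicate (r + (p ∸ r)) 0)
      ≡⟨ laneProduct-replicate r (p ∸ r) (suc n) n ⟩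
    s (suc n) ^ r * s n ^ (p ∸ r)
      ≡⟨ *-comm (s (suc n) ^ r) _ ⟩
    s n ^ (p ∸ r) * s (suc n) ^ r ∎
    where
    r+[p∸r]≡p : r + (p ∸ r) ≡ p
    r+[p∸r]≡p = m+[n∸m]≡n r≤p
    heights : List ℕ
    heights = replicate r (suc n) ++ replicate (p ∸ r) n
    lengths : length (replicate (r + (p ∸ r)) 0) ≡ length heights
    lengths = trans (length-replicate (r + (p ∸ r)))
                (sym (trans (length-++ (replicate r (suc n)))
                            (cong₂ _+_ (length-replicate r) (length-replicate (p ∸ r)))))

theorem2 : (p q : ℕ) → 1 ≤ p → 1 ≤ q →
           (v m : Fin q → ℕ) → (∀ i → 1 ≤ v i) → (∀ i → 1 ≤ m i) →
           (∀ i j → toℕ i < toℕ j → m i < m j) →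
           (s : ℕ → ℕ) → IsCombSeq q v m s →
           (n r : ℕ) → r < p →
           Tiling p q v m (p * n + r) ↔ Fin (s n ^ (p ∸ r) * s (suc n) ^ r)
theorem2 (suc p′) q _ _ v m _ m-pos _ s rec n r r<p =
  subst (λ c → Tiling p q v m (p * n + r) ↔ Fin c) (count-board p n r (<⇒≤ r<p))
    (↔-trans (tilings↔completions (p * n + r)) (completions↔ (p * n + r) (replicate p 0)))
  where
  open Window p′ using (p)
  open Scan v m
  open Tilings p′ v m m-pos
  open Counting v m m-pos s rec
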